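{- Let $d,n$ be positive integers and, for integers $e\geq 0$, let $U_e(n)=\sum_{k=1}^n \frac{2^{2k}}{\binom{2k}{k}} k^e$. Then \[ (2d+3)U_d(n) = \frac{(n+1)2^{2n+1}n^d}{\binom{2n}{n}} - \sum_{j=1}^d (-1)^j c_{d,j} U_{d-j}(n), \] where $c_{d,j} = \binom{d+1}{j+1} + \binom{d}{j+1}$, and \[ U_0(n) = \frac{1}{3}\left( \frac{(n+1)2^{2n+1}}{\binom{2n}{n}}-2\right). \]
   Context: Binomial coefficients $\binom{a}{b}$ with integers $0\le a<b$ are $0$. -}

module Defs where

open import Data.Nat as ℕ using (ℕ; zero; suc)
open import Data.Nat.Combinatorics using (_C_)
open import Data.Integer as ℤ using (ℤ; +_)
open import Data.Rational as ℚ using (ℚ; _/_; _+_; _*_; _-_; -_; 0ℚ)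

-- Total division of an integer by a natural; the value at denominator 0
-- is irrelevant here since it is only applied to central binomial
-- coefficients (2k choose k) ≥ 1.
_//_ : ℤ → ℕ → ℚ
a // zero = 0ℚ
a // suc b = a / suc b

ℕ→ℚ : ℕ → ℚ
ℕ→ℚ m = (+ m) / 1

Σ₁ : ℕ → (ℕ → ℚ) → ℚ
Σ₁ zero f = 0ℚ
Σ₁ (suc n) f = Σ₁ n f + f (suc n)

U : ℕ → ℕ → ℚ
U e n = Σ₁ n (λ k → (+ (2 ℕ.^ (2 ℕ.* k) ℕ.* k ℕ.^ e)) // ((2 ℕ.* k) C k))

c : ℕ → ℕ → ℕ
c d j = (suc d) C (suc j) ℕ.+ d C (suc j)

sign : ℕ → ℚ
sign zero = ℚ.1ℚ
sign (suc j) = - sign j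

mainTerm : ℕ → ℕ → ℚ
mainTerm d n = (+ (suc n ℕ.* 2 ℕ.^ suc (2 ℕ.* n) ℕ.* n ℕ.^ d)) // ((2 ℕ.* n) C n)

module Submission where

-- With A k = 4ᵏ / C(2k, k) we have (2k+1) A (k+1) = (2k+2) A k, so M k = 2(k+1) A k kᵈ
-- (the paper's main term) telescopes: M (k+1) - M k = A (k+1) ((2x+2) xᵈ - (2x-1)(x-1)ᵈ)
-- with x = k + 1.  Since c (d+1) (j+1) = c d j + c d (j+1), the polynomials
-- Pᵈ = Σ_{j=0}^{d} (-1)ʲ c d j x^{d-j} satisfy Pᵈ⁺¹ = (x-1) Pᵈ + 2xᵈ⁺¹, whence
-- Pᵈ = 2xᵈ⁺¹ - (2x-1)(x-1)ᵈ and (2x+2) xᵈ - (2x-1)(x-1)ᵈ = (2d+3) xᵈ + Σ_{j=1}^{d} (-1)ʲ c d j x^{d-j}.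
-- Weighting by A k and summing over k = 1 … n gives
-- (2d+3) U d n + Σⱼ (-1)ʲ c d j U (d-j) n = M n - M 0.

open import Defs
open import Data.Nat as ℕ using (ℕ; zero; suc; _∸_; _≤_; _<_; z≤n; s≤s)
import Data.Nat.Properties as ℕP
open import Data.Nat.Combinatorics using (_C_; nC1≡n; nCk+nC[k+1]≡[n+1]C[k+1]; k>n⇒nCk≡0; nCk≡nC[n∸k])
import Data.Nat.Tactic.RingSolver as ℕ-Solver
open import Data.Integer as ℤ using (+_)
import Data.Integer.Properties as ℤP
open import Data.Rational as ℚ using (ℚ; _+_; _*_; _-_; -_; 0ℚ; 1ℚ; _/_)
import Data.Rational.Properties as ℚP
open import Data.Rational.Unnormalised as ℚᵘ using (mkℚᵘ; *≡*)
import Data.Rational.Unnormalised.Properties as ℚᵘP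
open import Algebra.Bundles using (CommutativeMonoid)
open import Algebra.Properties.CommutativeSemigroup
  (CommutativeMonoid.commutativeSemigroup ℚP.+-0-commutativeMonoid) using (interchange)
open import Algebra.Properties.CommutativeSemigroup
  (CommutativeMonoid.commutativeSemigroup ℚP.*-1-commutativeMonoid) using (x∙yz≈y∙xz)
open import Algebra.Properties.CommutativeSemigroup ℕP.+-commutativeSemigroup
  using () renaming (interchange to ℕ-+-interchange)
open import Algebra.Definitions.RawSemiring ℚP.+-*-rawSemiring using (_^_)
import Tactic.RingSolver.Core.AlmostCommutativeRing as ACR
open import Tactic.RingSolver using (solve-∀)
open import Relation.Nullary.Decidable using (dec⇒maybe)
open import Level using (0ℓ)
open import Data.Product using (_×_; _,_)
open import Relation.Binary.PropositionalEquality
open ≡-Reasoning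

ℚ-ring : ACR.AlmostCommutativeRing 0ℓ 0ℓ
ℚ-ring = ACR.fromCommutativeRing ℚP.+-*-commutativeRing (λ x → dec⇒maybe (0ℚ ℚP.≟ x))

p+q≡r⇒q≡r-p : ∀ {p q r} → p + q ≡ r → q ≡ r - p
p+q≡r⇒q≡r-p {p} {q} refl = cancel p q
  where
  cancel : ∀ p q → q ≡ (p + q) - p
  cancel = solve-∀ ℚ-ring

fromℚᵘ-homo-+ : ∀ p q → ℚ.fromℚᵘ (p ℚᵘ.+ q) ≡ ℚ.fromℚᵘ p + ℚ.fromℚᵘ q
fromℚᵘ-homo-+ p q = ℚP.toℚᵘ-injective (ℚᵘP.≃-sym (ℚᵘP.≃-trans
  (ℚP.toℚᵘ-homo-+ (ℚ.fromℚᵘ p) (ℚ.fromℚᵘ q))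
  (ℚᵘP.≃-trans (ℚᵘP.+-cong (ℚP.toℚᵘ-fromℚᵘ p) (ℚP.toℚᵘ-fromℚᵘ q))
               (ℚᵘP.≃-sym (ℚP.toℚᵘ-fromℚᵘ (p ℚᵘ.+ q))))))

fromℚᵘ-homo-* : ∀ p q → ℚ.fromℚᵘ (p ℚᵘ.* q) ≡ ℚ.fromℚᵘ p * ℚ.fromℚᵘ q
fromℚᵘ-homo-* p q = ℚP.toℚᵘ-injective (ℚᵘP.≃-sym (ℚᵘP.≃-trans
  (ℚP.toℚᵘ-homo-* (ℚ.fromℚᵘ p) (ℚ.fromℚᵘ q))
  (ℚᵘP.≃-trans (ℚᵘP.*-cong (ℚP.toℚᵘ-fromℚᵘ p) (ℚP.toℚᵘ-fromℚᵘ q))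
               (ℚᵘP.≃-sym (ℚP.toℚᵘ-fromℚᵘ (p ℚᵘ.* q))))))

//-*-ℕ→ℚ : ∀ a b m → 0 < b → ((+ a) // b) * ℕ→ℚ m ≡ (+ (a ℕ.* m)) // b
//-*-ℕ→ℚ a (suc b) m _ = begin
  ((+ a) // suc b) * ℕ→ℚ m  ≡⟨ fromℚᵘ-homo-* p q ⟨
  ℚ.fromℚᵘ (p ℚᵘ.* q)      ≡⟨ ℚP.fromℚᵘ-cong {p ℚᵘ.* q} {r} (*≡* eq) ⟩
  (+ (a ℕ.* m)) // suc b    ∎
  where
  p = mkℚᵘ (+ a) b
  q = mkℚᵘ (+ m) 0
  r = mkℚᵘ (+ (a ℕ.* m)) b
  eq : (+ a ℤ.* + m) ℤ.* + suc b ≡ + (a ℕ.* m) ℤ.* + suc (b ℕ.* 1)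
  eq = cong₂ ℤ._*_ (sym (ℤP.pos-* a m)) (cong (λ n → + suc n) (sym (ℕP.*-identityʳ b)))

//-cross : ∀ a b c d → 0 < b → 0 < d → a ℕ.* d ≡ c ℕ.* b → (+ a) // b ≡ (+ c) // d
//-cross a (suc b) c (suc d) _ _ eq =
  ℚP.fromℚᵘ-cong {mkℚᵘ (+ a) b} {mkℚᵘ (+ c) d} (*≡* (begin
    + a ℤ.* + suc d   ≡⟨ ℤP.pos-* a (suc d) ⟨
    + (a ℕ.* suc d)   ≡⟨ cong +_ eq ⟩
    + (c ℕ.* suc b)   ≡⟨ ℤP.pos-* c (suc b) ⟩
    + c ℤ.* + suc b   ∎))

ℕ→ℚ-homo-+ : ∀ m n → ℕ→ℚ (m ℕ.+ n) ≡ ℕ→ℚ m + ℕ→ℚ n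
ℕ→ℚ-homo-+ m n =
  trans (ℚP.fromℚᵘ-cong {mkℚᵘ (+ (m ℕ.+ n)) 0} {p ℚᵘ.+ q} (*≡* eq)) (fromℚᵘ-homo-+ p q)
  where
  p = mkℚᵘ (+ m) 0
  q = mkℚᵘ (+ n) 0
  eq : + (m ℕ.+ n) ℤ.* + 1 ≡ (+ m ℤ.* + 1 ℤ.+ + n ℤ.* + 1) ℤ.* + 1
  eq = cong (ℤ._* + 1) (trans (ℤP.pos-+ m n)
         (sym (cong₂ ℤ._+_ (ℤP.*-identityʳ (+ m)) (ℤP.*-identityʳ (+ n)))))

ℕ→ℚ-homo-* : ∀ m n → ℕ→ℚ (m ℕ.* n) ≡ ℕ→ℚ m * ℕ→ℚ n
ℕ→ℚ-homo-* m n = sym (//-*-ℕ→ℚ m 1 n (s≤s z≤n))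

ℕ→ℚ-pred : ∀ n → ℕ→ℚ n ≡ ℕ→ℚ (suc n) - 1ℚ
ℕ→ℚ-pred n = p+q≡r⇒q≡r-p {ℕ→ℚ 1} {ℕ→ℚ n} (sym (ℕ→ℚ-homo-+ 1 n))

ℕ→ℚ-homo-^ : ∀ m e → ℕ→ℚ (m ℕ.^ e) ≡ ℕ→ℚ m ^ e
ℕ→ℚ-homo-^ m zero    = refl
ℕ→ℚ-homo-^ m (suc e) = trans (ℕ→ℚ-homo-* m (m ℕ.^ e)) (cong (ℕ→ℚ m *_) (ℕ→ℚ-homo-^ m e))


-‿+-interchange : ∀ a b c d → (a - b) + (c - d) ≡ (a + c) - (b + d)
-‿+-interchange = solve-∀ ℚ-ring

Σ₁-cong-≤ : ∀ n {f g : ℕ → ℚ} → (∀ k → k ≤ n → f k ≡ g k) → Σ₁ n f ≡ Σ₁ n g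
Σ₁-cong-≤ zero    f≡g = refl
Σ₁-cong-≤ (suc n) f≡g =
  cong₂ _+_ (Σ₁-cong-≤ n (λ k k≤n → f≡g k (ℕP.m≤n⇒m≤1+n k≤n))) (f≡g (suc n) ℕP.≤-refl)

Σ₁-cong : ∀ n {f g : ℕ → ℚ} → (∀ k → f k ≡ g k) → Σ₁ n f ≡ Σ₁ n g
Σ₁-cong n f≡g = Σ₁-cong-≤ n (λ k _ → f≡g k)

Σ₁-distrib-+ : ∀ n (f g : ℕ → ℚ) → Σ₁ n (λ k → f k + g k) ≡ Σ₁ n f + Σ₁ n g
Σ₁-distrib-+ zero    f g = refl
Σ₁-distrib-+ (suc n) f g = trans (cong (_+ (f (suc n) + g (suc n))) (Σ₁-distrib-+ n f g))
                                 (interchange (Σ₁ n f) (Σ₁ n g) (f (suc n)) (g (suc n)))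

Σ₁-distrib-- : ∀ n (f g : ℕ → ℚ) → Σ₁ n (λ k → f k - g k) ≡ Σ₁ n f - Σ₁ n g
Σ₁-distrib-- zero    f g = refl
Σ₁-distrib-- (suc n) f g = trans (cong (_+ (f (suc n) - g (suc n))) (Σ₁-distrib-- n f g))
                                 (-‿+-interchange (Σ₁ n f) (Σ₁ n g) (f (suc n)) (g (suc n)))

Σ₁-*ˡ : ∀ n a (f : ℕ → ℚ) → Σ₁ n (λ k → a * f k) ≡ a * Σ₁ n f
Σ₁-*ˡ zero    a f = sym (ℚP.*-zeroʳ a)
Σ₁-*ˡ (suc n) a f = trans (cong (_+ a * f (suc n)) (Σ₁-*ˡ n a f))
                          (sym (ℚP.*-distribˡ-+ a (Σ₁ n f) (f (suc n))))

Σ₁-zero : ∀ n → Σ₁ n (λ _ → 0ℚ) ≡ 0ℚ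
Σ₁-zero zero    = refl
Σ₁-zero (suc n) = trans (ℚP.+-identityʳ _) (Σ₁-zero n)

Σ₁-comm : ∀ m n (F : ℕ → ℕ → ℚ) →
          Σ₁ m (λ j → Σ₁ n (λ k → F j k)) ≡ Σ₁ n (λ k → Σ₁ m (λ j → F j k))
Σ₁-comm zero    n F = sym (Σ₁-zero n)
Σ₁-comm (suc m) n F = begin
  Σ₁ m (λ j → Σ₁ n (F j)) + Σ₁ n (F (suc m))
    ≡⟨ cong (_+ Σ₁ n (F (suc m))) (Σ₁-comm m n F) ⟩
  Σ₁ n (λ k → Σ₁ m (λ j → F j k)) + Σ₁ n (F (suc m))
    ≡⟨ Σ₁-distrib-+ n _ _ ⟨
  Σ₁ n (λ k → Σ₁ m (λ j → F j k) + F (suc m) k) ∎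

Σ₁-suc : ∀ n (f : ℕ → ℚ) → Σ₁ (suc n) f ≡ f 1 + Σ₁ n (λ k → f (suc k))
Σ₁-suc zero    f = ℚP.+-comm 0ℚ (f 1)
Σ₁-suc (suc n) f = trans (cong (_+ f (suc (suc n))) (Σ₁-suc n f))
                         (ℚP.+-assoc (f 1) _ (f (suc (suc n))))

Σ₁-telescope : ∀ n (g F : ℕ → ℚ) → (∀ k → g (suc k) ≡ F (suc k) - F k) → Σ₁ n g ≡ F n - F 0
Σ₁-telescope zero    g F step = sym (ℚP.+-inverseʳ (F 0))
Σ₁-telescope (suc n) g F step = begin
  Σ₁ n g + g (suc n)                   ≡⟨ cong₂ _+_ (Σ₁-telescope n g F step) (step n) ⟩
  (F n - F 0) + (F (suc n) - F n)      ≡⟨ collapse (F 0) (F n) (F (suc n)) ⟩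
  F (suc n) - F 0                      ∎
  where
  collapse : ∀ a b c → (b - a) + (c - b) ≡ c - a
  collapse = solve-∀ ℚ-ring

-- Polynomials in descending powers

Σ₀ : ℕ → (ℕ → ℚ) → ℚ
Σ₀ n f = f 0 + Σ₁ n f

Σ₀-cong : ∀ n {f g : ℕ → ℚ} → (∀ k → f k ≡ g k) → Σ₀ n f ≡ Σ₀ n g
Σ₀-cong n f≡g = cong₂ _+_ (f≡g 0) (Σ₁-cong n f≡g)

Σ₀-distrib-- : ∀ n (f g : ℕ → ℚ) → Σ₀ n (λ k → f k - g k) ≡ Σ₀ n f - Σ₀ n g
Σ₀-distrib-- n f g = trans (cong (λ s → (f 0 - g 0) + s) (Σ₁-distrib-- n f g))
                           (-‿+-interchange (f 0) (g 0) (Σ₁ n f) (Σ₁ n g))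

Σ₀-suc : ∀ n (f : ℕ → ℚ) → Σ₀ (suc n) f ≡ f 0 + Σ₀ n (λ k → f (suc k))
Σ₀-suc n f = cong (λ s → f 0 + s) (Σ₁-suc n f)

poly : (ℕ → ℚ) → ℕ → ℚ → ℚ
poly β d x = Σ₀ d (λ j → β j * x ^ (d ∸ j))

poly-suc : ∀ β d x → poly β (suc d) x ≡ β 0 * x ^ suc d + poly (λ j → β (suc j)) d x
poly-suc β d x = Σ₀-suc d (λ j → β j * x ^ (suc d ∸ j))

poly-horner : ∀ β d x → poly β (suc d) x ≡ x * poly β d x + β (suc d)
poly-horner β d x = begin
  β 0 * x ^ suc d + (Σ₁ d (λ j → β j * x ^ (suc d ∸ j)) + β (suc d) * x ^ (d ∸ d))
    ≡⟨ cong₂ (λ s e → β 0 * x ^ suc d + (s + β (suc d) * x ^ e)) lower-terms (ℕP.n∸n≡0 d) ⟩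
  β 0 * (x * x ^ d) + (x * Σ₁ d (λ j → β j * x ^ (d ∸ j)) + β (suc d) * 1ℚ)
    ≡⟨ regroup (β 0) (x ^ d) x (Σ₁ d (λ j → β j * x ^ (d ∸ j))) (β (suc d)) ⟩
  x * poly β d x + β (suc d) ∎
  where
  lower-terms : Σ₁ d (λ j → β j * x ^ (suc d ∸ j)) ≡ x * Σ₁ d (λ j → β j * x ^ (d ∸ j))
  lower-terms = trans (Σ₁-cong-≤ d (λ j j≤d → begin
      β j * x ^ (suc d ∸ j)   ≡⟨ cong (λ e → β j * x ^ e) (ℕP.+-∸-assoc 1 j≤d) ⟩
      β j * (x * x ^ (d ∸ j)) ≡⟨ x∙yz≈y∙xz (β j) x (x ^ (d ∸ j)) ⟩
      x * (β j * x ^ (d ∸ j)) ∎))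
    (Σ₁-*ˡ d x _)
  regroup : ∀ b X x S e → b * (x * X) + (x * S + e * 1ℚ) ≡ x * (b * X + S) + e
  regroup = solve-∀ ℚ-ring

-- Multiplying by x - 1 takes differences of consecutive coefficients.
poly-pascal : ∀ (β β′ : ℕ → ℚ) d x →
              (∀ j → β′ (suc j) ≡ β (suc j) - β j) → β (suc d) ≡ 0ℚ →
              poly β′ (suc d) x ≡ (x - 1ℚ) * poly β d x + (β′ 0 - β 0) * x ^ suc d
poly-pascal β β′ d x pascal β-top = begin
  poly β′ (suc d) x
    ≡⟨ poly-suc β′ d x ⟩
  β′ 0 * X + poly (λ j → β′ (suc j)) d x
    ≡⟨ cong (λ s → β′ 0 * X + s) differences ⟩
  β′ 0 * X + (poly (λ j → β (suc j)) d x - P)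
    ≡⟨ cong (λ s → β′ 0 * X + (s - P)) shifted ⟩
  β′ 0 * X + ((x * P + β (suc d) - β 0 * X) - P)
    ≡⟨ cong (λ t → β′ 0 * X + ((x * P + t - β 0 * X) - P)) β-top ⟩
  β′ 0 * X + ((x * P + 0ℚ - β 0 * X) - P)
    ≡⟨ regroup (β′ 0) (β 0) X P x ⟩
  (x - 1ℚ) * P + (β′ 0 - β 0) * X ∎
  where
  X = x ^ suc d
  P = poly β d x
  differences : poly (λ j → β′ (suc j)) d x ≡ poly (λ j → β (suc j)) d x - P
  differences = trans
    (Σ₀-cong d (λ j → trans (cong (_* x ^ (d ∸ j)) (pascal j))
                            (*-distribʳ-- (β (suc j)) (β j) (x ^ (d ∸ j)))))
    (Σ₀-distrib-- d (λ j → β (suc j) * x ^ (d ∸ j)) (λ j → β j * x ^ (d ∸ j)))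
    where
    *-distribʳ-- : ∀ a b y → (a - b) * y ≡ a * y - b * y
    *-distribʳ-- = solve-∀ ℚ-ring
  shifted : poly (λ j → β (suc j)) d x ≡ x * P + β (suc d) - β 0 * X
  shifted = p+q≡r⇒q≡r-p (trans (sym (poly-suc β d x)) (poly-horner β d x))
  regroup : ∀ b′ b X P x → b′ * X + ((x * P + 0ℚ - b * X) - P) ≡ (x - 1ℚ) * P + (b′ - b) * X
  regroup = solve-∀ ℚ-ring

-- The coefficients c d j

c-zero : ∀ d → c d 0 ≡ 1 ℕ.+ 2 ℕ.* d
c-zero d = trans (cong₂ ℕ._+_ (nC1≡n (suc d)) (nC1≡n d)) (arith d)
  where
  arith : ∀ d → suc d ℕ.+ d ≡ 1 ℕ.+ 2 ℕ.* d
  arith = ℕ-Solver.solve-∀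

c-pascal : ∀ d j → c (suc d) (suc j) ≡ c d j ℕ.+ c d (suc j)
c-pascal d j = begin
  suc (suc d) C suc (suc j) ℕ.+ suc d C suc (suc j)
    ≡⟨ cong₂ ℕ._+_ (nCk+nC[k+1]≡[n+1]C[k+1] (suc d) (suc j)) (nCk+nC[k+1]≡[n+1]C[k+1] d (suc j)) ⟨
  (suc d C suc j ℕ.+ suc d C suc (suc j)) ℕ.+ (d C suc j ℕ.+ d C suc (suc j))
    ≡⟨ ℕ-+-interchange (suc d C suc j) _ (d C suc j) _ ⟩
  c d j ℕ.+ c d (suc j) ∎

c-top : ∀ d → c d (suc d) ≡ 0
c-top d = cong₂ ℕ._+_ (k>n⇒nCk≡0 (ℕP.n<1+n (suc d))) (k>n⇒nCk≡0 (ℕP.m<n⇒m<1+n (ℕP.n<1+n d)))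

signedC : ℕ → ℕ → ℚ
signedC d j = sign j * ℕ→ℚ (c d j)

signedC-pascal : ∀ d j → signedC (suc d) (suc j) ≡ signedC d (suc j) - signedC d j
signedC-pascal d j = begin
  - sign j * ℕ→ℚ (c (suc d) (suc j))            ≡⟨ cong (λ n → - sign j * ℕ→ℚ n) (c-pascal d j) ⟩
  - sign j * ℕ→ℚ (c d j ℕ.+ c d (suc j))        ≡⟨ cong (- sign j *_) (ℕ→ℚ-homo-+ (c d j) (c d (suc j))) ⟩
  - sign j * (ℕ→ℚ (c d j) + ℕ→ℚ (c d (suc j))) ≡⟨ regroup (sign j) (ℕ→ℚ (c d j)) (ℕ→ℚ (c d (suc j))) ⟩
  signedC d (suc j) - signedC d j               ∎
  where
  regroup : ∀ s a b → (- s) * (a + b) ≡ (- s) * b - s * a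
  regroup = solve-∀ ℚ-ring

signedC-top : ∀ d → signedC d (suc d) ≡ 0ℚ
signedC-top d = trans (cong (λ n → sign (suc d) * ℕ→ℚ n) (c-top d)) (ℚP.*-zeroʳ (sign (suc d)))

signedC-zero : ∀ d → signedC d 0 ≡ ℕ→ℚ (1 ℕ.+ 2 ℕ.* d)
signedC-zero d = trans (ℚP.*-identityˡ (ℕ→ℚ (c d 0))) (cong ℕ→ℚ (c-zero d))

poly-signedC : ∀ d x →
  poly (signedC d) d x ≡ ℕ→ℚ 2 * x ^ suc d - (ℕ→ℚ 2 * x - 1ℚ) * (x - 1ℚ) ^ d
poly-signedC zero    x = base x
  where
  base : ∀ x → 1ℚ ≡ ℕ→ℚ 2 * (x * 1ℚ) - (ℕ→ℚ 2 * x - 1ℚ) * 1ℚ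
  base = solve-∀ ℚ-ring
poly-signedC (suc d) x = begin
  poly (signedC (suc d)) (suc d) x
    ≡⟨ poly-pascal (signedC d) (signedC (suc d)) d x (signedC-pascal d) (signedC-top d) ⟩
  (x - 1ℚ) * poly (signedC d) d x + (signedC (suc d) 0 - signedC d 0) * x ^ suc d
    ≡⟨ cong₂ (λ p δ → (x - 1ℚ) * p + δ * x ^ suc d) (poly-signedC d x) leading ⟩
  (x - 1ℚ) * (ℕ→ℚ 2 * x ^ suc d - (ℕ→ℚ 2 * x - 1ℚ) * (x - 1ℚ) ^ d) + ℕ→ℚ 2 * x ^ suc d
    ≡⟨ regroup x (x ^ d) ((x - 1ℚ) ^ d) ⟩
  ℕ→ℚ 2 * x ^ suc (suc d) - (ℕ→ℚ 2 * x - 1ℚ) * (x - 1ℚ) ^ suc d ∎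
  where
  leading : signedC (suc d) 0 - signedC d 0 ≡ ℕ→ℚ 2
  leading = begin
    signedC (suc d) 0 - signedC d 0      ≡⟨ cong₂ _-_ (signedC-zero (suc d)) (signedC-zero d) ⟩
    ℕ→ℚ (1 ℕ.+ 2 ℕ.* suc d) - ℕ→ℚ m      ≡⟨ cong (λ n → ℕ→ℚ n - ℕ→ℚ m) (arith d) ⟩
    ℕ→ℚ (2 ℕ.+ m) - ℕ→ℚ m                ≡⟨ cong (_- ℕ→ℚ m) (ℕ→ℚ-homo-+ 2 m) ⟩
    ℕ→ℚ 2 + ℕ→ℚ m - ℕ→ℚ m                ≡⟨ cancel (ℕ→ℚ m) ⟩
    ℕ→ℚ 2                                ∎
    where
    m = 1 ℕ.+ 2 ℕ.* d
    arith : ∀ d → 1 ℕ.+ 2 ℕ.* suc d ≡ 2 ℕ.+ (1 ℕ.+ 2 ℕ.* d)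
    arith = ℕ-Solver.solve-∀
    cancel : ∀ a → ℕ→ℚ 2 + a - a ≡ ℕ→ℚ 2
    cancel = solve-∀ ℚ-ring
  regroup : ∀ x X Y → (x - 1ℚ) * (ℕ→ℚ 2 * (x * X) - (ℕ→ℚ 2 * x - 1ℚ) * Y) + ℕ→ℚ 2 * (x * X)
                    ≡ ℕ→ℚ 2 * (x * (x * X)) - (ℕ→ℚ 2 * x - 1ℚ) * ((x - 1ℚ) * Y)
  regroup = solve-∀ ℚ-ring

key-polynomial-identity : ∀ d x →
  ℕ→ℚ (2 ℕ.* d ℕ.+ 3) * x ^ d + Σ₁ d (λ j → signedC d j * x ^ (d ∸ j))
    ≡ (ℕ→ℚ 2 * x + ℕ→ℚ 2) * x ^ d - (ℕ→ℚ 2 * x - 1ℚ) * (x - 1ℚ) ^ d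
key-polynomial-identity d x = begin
  ℕ→ℚ (2 ℕ.* d ℕ.+ 3) * X + S
    ≡⟨ cong (λ a → a * X + S) leading ⟩
  (ℕ→ℚ 2 + signedC d 0) * X + S
    ≡⟨ regroup (signedC d 0) X S ⟩
  ℕ→ℚ 2 * X + poly (signedC d) d x
    ≡⟨ cong (λ p → ℕ→ℚ 2 * X + p) (poly-signedC d x) ⟩
  ℕ→ℚ 2 * X + (ℕ→ℚ 2 * (x * X) - (ℕ→ℚ 2 * x - 1ℚ) * (x - 1ℚ) ^ d)
    ≡⟨ regroup′ x X ((x - 1ℚ) ^ d) ⟩
  (ℕ→ℚ 2 * x + ℕ→ℚ 2) * X - (ℕ→ℚ 2 * x - 1ℚ) * (x - 1ℚ) ^ d ∎
  where
  X = x ^ d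
  S = Σ₁ d (λ j → signedC d j * x ^ (d ∸ j))
  leading : ℕ→ℚ (2 ℕ.* d ℕ.+ 3) ≡ ℕ→ℚ 2 + signedC d 0
  leading = begin
    ℕ→ℚ (2 ℕ.* d ℕ.+ 3)            ≡⟨ cong ℕ→ℚ (arith d) ⟩
    ℕ→ℚ (2 ℕ.+ (1 ℕ.+ 2 ℕ.* d))    ≡⟨ ℕ→ℚ-homo-+ 2 (1 ℕ.+ 2 ℕ.* d) ⟩
    ℕ→ℚ 2 + ℕ→ℚ (1 ℕ.+ 2 ℕ.* d)    ≡⟨ cong (λ s → ℕ→ℚ 2 + s) (signedC-zero d) ⟨
    ℕ→ℚ 2 + signedC d 0            ∎
    where
    arith : ∀ d → 2 ℕ.* d ℕ.+ 3 ≡ 2 ℕ.+ (1 ℕ.+ 2 ℕ.* d)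
    arith = ℕ-Solver.solve-∀
  regroup : ∀ s X S → (ℕ→ℚ 2 + s) * X + S ≡ ℕ→ℚ 2 * X + (s * X + S)
  regroup = solve-∀ ℚ-ring
  regroup′ : ∀ x X Y → ℕ→ℚ 2 * X + (ℕ→ℚ 2 * (x * X) - (ℕ→ℚ 2 * x - 1ℚ) * Y)
                     ≡ (ℕ→ℚ 2 * x + ℕ→ℚ 2) * X - (ℕ→ℚ 2 * x - 1ℚ) * Y
  regroup′ = solve-∀ ℚ-ring

-- Central binomial coefficients

nCk>0 : ∀ n k → k ≤ n → 0 < n C k
nCk>0 n       zero    _         = s≤s z≤n
nCk>0 (suc n) (suc k) (s≤s k≤n) = subst (0 <_) (nCk+nC[k+1]≡[n+1]C[k+1] n k)
  (ℕP.≤-trans (nCk>0 n k k≤n) (ℕP.m≤m+n (n C k) (n C suc k)))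

[k+1]*[n+1]C[k+1]≡[n+1]*nCk : ∀ n k → suc k ℕ.* (suc n C suc k) ≡ suc n ℕ.* (n C k)
[k+1]*[n+1]C[k+1]≡[n+1]*nCk zero    zero    = refl
[k+1]*[n+1]C[k+1]≡[n+1]*nCk zero    (suc k) =
  trans (cong (suc (suc k) ℕ.*_) (k>n⇒nCk≡0 {1} {suc (suc k)} (s≤s (s≤s z≤n))))
        (ℕP.*-zeroʳ (suc (suc k)))
[k+1]*[n+1]C[k+1]≡[n+1]*nCk (suc n) zero    =
  trans (ℕP.*-identityˡ _) (trans (nC1≡n (suc (suc n))) (sym (ℕP.*-identityʳ (suc (suc n)))))
[k+1]*[n+1]C[k+1]≡[n+1]*nCk (suc n) (suc k) = begin
  suc (suc k) ℕ.* (suc (suc n) C suc (suc k))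
    ≡⟨ cong (suc (suc k) ℕ.*_) (nCk+nC[k+1]≡[n+1]C[k+1] (suc n) (suc k)) ⟨
  suc (suc k) ℕ.* (suc n C suc k ℕ.+ suc n C suc (suc k))
    ≡⟨ split k (suc n C suc k) (suc n C suc (suc k)) ⟩
  suc k ℕ.* (suc n C suc k) ℕ.+ suc n C suc k ℕ.+ suc (suc k) ℕ.* (suc n C suc (suc k))
    ≡⟨ cong₂ (λ a b → a ℕ.+ suc n C suc k ℕ.+ b)
             ([k+1]*[n+1]C[k+1]≡[n+1]*nCk n k) ([k+1]*[n+1]C[k+1]≡[n+1]*nCk n (suc k)) ⟩
  suc n ℕ.* (n C k) ℕ.+ suc n C suc k ℕ.+ suc n ℕ.* (n C suc k)
    ≡⟨ cong (λ a → suc n ℕ.* (n C k) ℕ.+ a ℕ.+ suc n ℕ.* (n C suc k)) (nCk+nC[k+1]≡[n+1]C[k+1] n k) ⟨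
  suc n ℕ.* (n C k) ℕ.+ (n C k ℕ.+ n C suc k) ℕ.+ suc n ℕ.* (n C suc k)
    ≡⟨ merge n (n C k) (n C suc k) ⟩
  suc (suc n) ℕ.* (n C k ℕ.+ n C suc k)
    ≡⟨ cong (suc (suc n) ℕ.*_) (nCk+nC[k+1]≡[n+1]C[k+1] n k) ⟩
  suc (suc n) ℕ.* (suc n C suc k) ∎
  where
  split : ∀ k p q → suc (suc k) ℕ.* (p ℕ.+ q) ≡ suc k ℕ.* p ℕ.+ p ℕ.+ suc (suc k) ℕ.* q
  split = ℕ-Solver.solve-∀
  merge : ∀ n x y → suc n ℕ.* x ℕ.+ (x ℕ.+ y) ℕ.+ suc n ℕ.* y ≡ suc (suc n) ℕ.* (x ℕ.+ y)
  merge = ℕ-Solver.solve-∀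

central-binomial-suc : ∀ k →
  suc k ℕ.* ((2 ℕ.* suc k) C suc k) ≡ 2 ℕ.* (suc (2 ℕ.* k) ℕ.* ((2 ℕ.* k) C k))
central-binomial-suc k = begin
  suc k ℕ.* ((2 ℕ.* suc k) C suc k)
    ≡⟨ cong (λ m → suc k ℕ.* (m C suc k)) (ℕP.*-suc 2 k) ⟩
  suc k ℕ.* (suc (suc (2 ℕ.* k)) C suc k)
    ≡⟨ [k+1]*[n+1]C[k+1]≡[n+1]*nCk (suc (2 ℕ.* k)) k ⟩
  suc (suc (2 ℕ.* k)) ℕ.* (suc (2 ℕ.* k) C k)
    ≡⟨ cong (suc (suc (2 ℕ.* k)) ℕ.*_) symmetry ⟩
  suc (suc (2 ℕ.* k)) ℕ.* (suc (2 ℕ.* k) C suc k)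
    ≡⟨ regroup k (suc (2 ℕ.* k) C suc k) ⟩
  2 ℕ.* (suc k ℕ.* (suc (2 ℕ.* k) C suc k))
    ≡⟨ cong (2 ℕ.*_) ([k+1]*[n+1]C[k+1]≡[n+1]*nCk (2 ℕ.* k) k) ⟩
  2 ℕ.* (suc (2 ℕ.* k) ℕ.* ((2 ℕ.* k) C k)) ∎
  where
  k≤2k : k ≤ suc (2 ℕ.* k)
  k≤2k = ℕP.m≤n⇒m≤1+n (ℕP.m≤m+n k (k ℕ.+ 0))
  symmetry : suc (2 ℕ.* k) C k ≡ suc (2 ℕ.* k) C suc k
  symmetry = trans (nCk≡nC[n∸k] k≤2k) (cong (suc (2 ℕ.* k) C_) (complement k))
    where
    complement : ∀ k → suc (2 ℕ.* k) ∸ k ≡ suc k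
    complement k = trans (ℕP.+-∸-assoc 1 (ℕP.m≤m+n k (k ℕ.+ 0)))
                         (cong suc (trans (ℕP.m+n∸m≡n k (k ℕ.+ 0)) (ℕP.+-identityʳ k)))
  regroup : ∀ k x → suc (suc (2 ℕ.* k)) ℕ.* x ≡ 2 ℕ.* (suc k ℕ.* x)
  regroup = ℕ-Solver.solve-∀

central>0 : ∀ k → 0 < (2 ℕ.* k) C k
central>0 k = nCk>0 (2 ℕ.* k) k (ℕP.m≤m+n k (k ℕ.+ 0))

A : ℕ → ℚ
A k = (+ (2 ℕ.^ (2 ℕ.* k))) // ((2 ℕ.* k) C k)

U≡ΣA : ∀ e n → U e n ≡ Σ₁ n (λ k → A k * ℕ→ℚ k ^ e)
U≡ΣA e n = Σ₁-cong n (λ k → begin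
  (+ (2 ℕ.^ (2 ℕ.* k) ℕ.* k ℕ.^ e)) // ((2 ℕ.* k) C k) ≡⟨ //-*-ℕ→ℚ _ _ (k ℕ.^ e) (central>0 k) ⟨
  A k * ℕ→ℚ (k ℕ.^ e)                                  ≡⟨ cong (A k *_) (ℕ→ℚ-homo-^ k e) ⟩
  A k * ℕ→ℚ k ^ e                                      ∎)

mainTerm≡2[n+1]A : ∀ d n → mainTerm d n ≡ ℕ→ℚ (2 ℕ.* suc n) * A n * ℕ→ℚ n ^ d
mainTerm≡2[n+1]A d n = begin
  (+ (suc n ℕ.* 2 ℕ.^ suc (2 ℕ.* n) ℕ.* n ℕ.^ d)) // ((2 ℕ.* n) C n)
    ≡⟨ cong (λ m → (+ m) // ((2 ℕ.* n) C n)) (arith n (2 ℕ.^ (2 ℕ.* n)) (n ℕ.^ d)) ⟩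
  (+ (2 ℕ.^ (2 ℕ.* n) ℕ.* (2 ℕ.* suc n ℕ.* n ℕ.^ d))) // ((2 ℕ.* n) C n)
    ≡⟨ //-*-ℕ→ℚ _ _ (2 ℕ.* suc n ℕ.* n ℕ.^ d) (central>0 n) ⟨
  A n * ℕ→ℚ (2 ℕ.* suc n ℕ.* n ℕ.^ d)
    ≡⟨ cong (A n *_) (ℕ→ℚ-homo-* (2 ℕ.* suc n) (n ℕ.^ d)) ⟩
  A n * (ℕ→ℚ (2 ℕ.* suc n) * ℕ→ℚ (n ℕ.^ d))
    ≡⟨ cong (λ t → A n * (ℕ→ℚ (2 ℕ.* suc n) * t)) (ℕ→ℚ-homo-^ n d) ⟩
  A n * (ℕ→ℚ (2 ℕ.* suc n) * ℕ→ℚ n ^ d)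
    ≡⟨ regroup (A n) (ℕ→ℚ (2 ℕ.* suc n)) (ℕ→ℚ n ^ d) ⟩
  ℕ→ℚ (2 ℕ.* suc n) * A n * ℕ→ℚ n ^ d ∎
  where
  arith : ∀ n p q → suc n ℕ.* (2 ℕ.* p) ℕ.* q ≡ p ℕ.* (2 ℕ.* suc n ℕ.* q)
  arith = ℕ-Solver.solve-∀
  regroup : ∀ a t y → a * (t * y) ≡ t * a * y
  regroup = solve-∀ ℚ-ring

A-suc : ∀ k → ℕ→ℚ (suc (2 ℕ.* k)) * A (suc k) ≡ ℕ→ℚ (2 ℕ.* suc k) * A k
A-suc k = begin
  ℕ→ℚ (suc (2 ℕ.* k)) * A (suc k)
    ≡⟨ ℚP.*-comm _ (A (suc k)) ⟩
  A (suc k) * ℕ→ℚ (suc (2 ℕ.* k))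
    ≡⟨ //-*-ℕ→ℚ _ _ _ (central>0 (suc k)) ⟩
  (+ (2 ℕ.^ (2 ℕ.* suc k) ℕ.* suc (2 ℕ.* k))) // b′
    ≡⟨ //-cross _ _ _ _ (central>0 (suc k)) (central>0 k) cross ⟩
  (+ (p ℕ.* (2 ℕ.* suc k))) // b
    ≡⟨ //-*-ℕ→ℚ _ _ _ (central>0 k) ⟨
  A k * ℕ→ℚ (2 ℕ.* suc k)
    ≡⟨ ℚP.*-comm (A k) _ ⟩
  ℕ→ℚ (2 ℕ.* suc k) * A k ∎
  where
  p = 2 ℕ.^ (2 ℕ.* k)
  b = (2 ℕ.* k) C k
  b′ = (2 ℕ.* suc k) C suc k
  cross : 2 ℕ.^ (2 ℕ.* suc k) ℕ.* suc (2 ℕ.* k) ℕ.* b ≡ p ℕ.* (2 ℕ.* suc k) ℕ.* b′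
  cross = begin
    2 ℕ.^ (2 ℕ.* suc k) ℕ.* suc (2 ℕ.* k) ℕ.* b
      ≡⟨ cong (λ e → 2 ℕ.^ e ℕ.* suc (2 ℕ.* k) ℕ.* b) (ℕP.*-suc 2 k) ⟩
    2 ℕ.* (2 ℕ.* p) ℕ.* suc (2 ℕ.* k) ℕ.* b
      ≡⟨ regroup k p b ⟩
    2 ℕ.* p ℕ.* (2 ℕ.* (suc (2 ℕ.* k) ℕ.* b))
      ≡⟨ cong (2 ℕ.* p ℕ.*_) (central-binomial-suc k) ⟨
    2 ℕ.* p ℕ.* (suc k ℕ.* b′)
      ≡⟨ regroup′ k p b′ ⟩
    p ℕ.* (2 ℕ.* suc k) ℕ.* b′ ∎
    where
    regroup : ∀ k p c →
      2 ℕ.* (2 ℕ.* p) ℕ.* suc (2 ℕ.* k) ℕ.* c ≡ 2 ℕ.* p ℕ.* (2 ℕ.* (suc (2 ℕ.* k) ℕ.* c))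
    regroup = ℕ-Solver.solve-∀
    regroup′ : ∀ k p c → 2 ℕ.* p ℕ.* (suc k ℕ.* c) ≡ p ℕ.* (2 ℕ.* suc k) ℕ.* c
    regroup′ = ℕ-Solver.solve-∀

mainTerm-step : ∀ d k → let x = ℕ→ℚ (suc k) in
  mainTerm d (suc k) - mainTerm d k
    ≡ A (suc k) * ((ℕ→ℚ 2 * x + ℕ→ℚ 2) * x ^ d - (ℕ→ℚ 2 * x - 1ℚ) * (x - 1ℚ) ^ d)
mainTerm-step d k = begin
  mainTerm d (suc k) - mainTerm d k
    ≡⟨ cong₂ _-_ (mainTerm≡2[n+1]A d (suc k)) (mainTerm≡2[n+1]A d k) ⟩
  ℕ→ℚ (2 ℕ.* suc (suc k)) * A′ * x ^ d - ℕ→ℚ (2 ℕ.* suc k) * A k * ℕ→ℚ k ^ d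
    ≡⟨ cong (λ t → ℕ→ℚ (2 ℕ.* suc (suc k)) * A′ * x ^ d - t * ℕ→ℚ k ^ d) (A-suc k) ⟨
  ℕ→ℚ (2 ℕ.* suc (suc k)) * A′ * x ^ d - ℕ→ℚ (suc (2 ℕ.* k)) * A′ * ℕ→ℚ k ^ d
    ≡⟨ cong₂ (λ a b → a * A′ * x ^ d - b * A′ * ℕ→ℚ k ^ d) ℕ→ℚ[2k+4] ℕ→ℚ[2k+1] ⟩
  ℕ→ℚ 2 * (1ℚ + x) * A′ * x ^ d - (ℕ→ℚ 2 * x - 1ℚ) * A′ * ℕ→ℚ k ^ d
    ≡⟨ cong (λ y → ℕ→ℚ 2 * (1ℚ + x) * A′ * x ^ d - (ℕ→ℚ 2 * x - 1ℚ) * A′ * y ^ d) (ℕ→ℚ-pred k) ⟩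
  ℕ→ℚ 2 * (1ℚ + x) * A′ * x ^ d - (ℕ→ℚ 2 * x - 1ℚ) * A′ * (x - 1ℚ) ^ d
    ≡⟨ regroup x A′ (x ^ d) ((x - 1ℚ) ^ d) ⟩
  A′ * ((ℕ→ℚ 2 * x + ℕ→ℚ 2) * x ^ d - (ℕ→ℚ 2 * x - 1ℚ) * (x - 1ℚ) ^ d) ∎
  where
  x = ℕ→ℚ (suc k)
  A′ = A (suc k)
  ℕ→ℚ[2k+4] : ℕ→ℚ (2 ℕ.* suc (suc k)) ≡ ℕ→ℚ 2 * (1ℚ + x)
  ℕ→ℚ[2k+4] = trans (ℕ→ℚ-homo-* 2 (suc (suc k))) (cong (ℕ→ℚ 2 *_) (ℕ→ℚ-homo-+ 1 (suc k)))
  ℕ→ℚ[2k+1] : ℕ→ℚ (suc (2 ℕ.* k)) ≡ ℕ→ℚ 2 * x - 1ℚ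
  ℕ→ℚ[2k+1] = begin
    ℕ→ℚ (suc (2 ℕ.* k))            ≡⟨ ℕ→ℚ-pred (suc (2 ℕ.* k)) ⟩
    ℕ→ℚ (suc (suc (2 ℕ.* k))) - 1ℚ ≡⟨ cong (λ n → ℕ→ℚ n - 1ℚ) (ℕP.*-suc 2 k) ⟨
    ℕ→ℚ (2 ℕ.* suc k) - 1ℚ         ≡⟨ cong (_- 1ℚ) (ℕ→ℚ-homo-* 2 (suc k)) ⟩
    ℕ→ℚ 2 * x - 1ℚ                 ∎
  regroup : ∀ x a X Y → ℕ→ℚ 2 * (1ℚ + x) * a * X - (ℕ→ℚ 2 * x - 1ℚ) * a * Y
                      ≡ a * ((ℕ→ℚ 2 * x + ℕ→ℚ 2) * X - (ℕ→ℚ 2 * x - 1ℚ) * Y)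
  regroup = solve-∀ ℚ-ring

U-linear : ∀ a d n (w : ℕ → ℚ) →
  a * U d n + Σ₁ d (λ j → w j * U (d ∸ j) n)
    ≡ Σ₁ n (λ k → A k * (a * ℕ→ℚ k ^ d + Σ₁ d (λ j → w j * ℕ→ℚ k ^ (d ∸ j))))
U-linear a d n w = begin
  a * U d n + Σ₁ d (λ j → w j * U (d ∸ j) n)
    ≡⟨ cong₂ _+_ leading lower ⟩
  Σ₁ n (λ k → A k * (a * y k ^ d)) + Σ₁ n (λ k → A k * Σ₁ d (λ j → w j * y k ^ (d ∸ j)))
    ≡⟨ Σ₁-distrib-+ n _ _ ⟨
  Σ₁ n (λ k → A k * (a * y k ^ d) + A k * Σ₁ d (λ j → w j * y k ^ (d ∸ j)))
    ≡⟨ Σ₁-cong n (λ k → sym (ℚP.*-distribˡ-+ (A k) _ _)) ⟩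
  Σ₁ n (λ k → A k * (a * y k ^ d + Σ₁ d (λ j → w j * y k ^ (d ∸ j)))) ∎
  where
  y = ℕ→ℚ
  leading : a * U d n ≡ Σ₁ n (λ k → A k * (a * y k ^ d))
  leading = begin
    a * U d n                          ≡⟨ cong (a *_) (U≡ΣA d n) ⟩
    a * Σ₁ n (λ k → A k * y k ^ d)     ≡⟨ Σ₁-*ˡ n a _ ⟨
    Σ₁ n (λ k → a * (A k * y k ^ d))   ≡⟨ Σ₁-cong n (λ k → x∙yz≈y∙xz a (A k) (y k ^ d)) ⟩
    Σ₁ n (λ k → A k * (a * y k ^ d))   ∎
  lower : Σ₁ d (λ j → w j * U (d ∸ j) n) ≡ Σ₁ n (λ k → A k * Σ₁ d (λ j → w j * y k ^ (d ∸ j)))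
  lower = begin
    Σ₁ d (λ j → w j * U (d ∸ j) n)
      ≡⟨ Σ₁-cong d (λ j → trans (cong (w j *_) (U≡ΣA (d ∸ j) n)) (sym (Σ₁-*ˡ n (w j) _))) ⟩
    Σ₁ d (λ j → Σ₁ n (λ k → w j * (A k * y k ^ (d ∸ j))))
      ≡⟨ Σ₁-comm d n _ ⟩
    Σ₁ n (λ k → Σ₁ d (λ j → w j * (A k * y k ^ (d ∸ j))))
      ≡⟨ Σ₁-cong n (λ k → trans (Σ₁-cong d (λ j → x∙yz≈y∙xz (w j) (A k) _)) (Σ₁-*ˡ d (A k) _)) ⟩
    Σ₁ n (λ k → A k * Σ₁ d (λ j → w j * y k ^ (d ∸ j))) ∎

U-recurrence : ∀ d n →
  ℕ→ℚ (2 ℕ.* d ℕ.+ 3) * U d n + Σ₁ d (λ j → signedC d j * U (d ∸ j) n)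
    ≡ mainTerm d n - mainTerm d 0
U-recurrence d n = trans (U-linear (ℕ→ℚ (2 ℕ.* d ℕ.+ 3)) d n (signedC d))
  (Σ₁-telescope n _ (mainTerm d) (λ k →
    trans (cong (A (suc k) *_) (key-polynomial-identity d (ℕ→ℚ (suc k)))) (sym (mainTerm-step d k))))

-- The boundary term mainTerm d 0 reduces
-- to 0ℚ for d ≥ 1 and to ℕ→ℚ 2 for d = 0.
theorem3p1 : (d n : ℕ) → 1 ℕ.≤ d → 1 ℕ.≤ n →
    (ℕ→ℚ (2 ℕ.* d ℕ.+ 3) * U d n
      ≡ mainTerm d n - Σ₁ d (λ j → sign j * ℕ→ℚ (c d j) * U (d ∸ j) n))
    × (U 0 n ≡ (+ 1 / 3) * (mainTerm 0 n - ℕ→ℚ 2))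
theorem3p1 (suc d) n _ _ = recurrence , U₀-closed-form
  where
  a = ℕ→ℚ (2 ℕ.* suc d ℕ.+ 3) * U (suc d) n
  S = Σ₁ (suc d) (λ j → signedC (suc d) j * U (suc d ∸ j) n)
  recurrence : a ≡ mainTerm (suc d) n - S
  recurrence = trans (p+q≡r⇒q≡r-p (trans (ℚP.+-comm S a) (U-recurrence (suc d) n)))
                     (cong (_- S) (ℚP.+-identityʳ (mainTerm (suc d) n)))
  U₀-closed-form : U 0 n ≡ (+ 1 / 3) * (mainTerm 0 n - ℕ→ℚ 2)
  U₀-closed-form = begin
    U 0 n                               ≡⟨ ℚP.*-identityˡ (U 0 n) ⟨
    ((+ 1 / 3) * ℕ→ℚ 3) * U 0 n         ≡⟨ ℚP.*-assoc (+ 1 / 3) (ℕ→ℚ 3) (U 0 n) ⟩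
    (+ 1 / 3) * (ℕ→ℚ 3 * U 0 n)         ≡⟨ cong ((+ 1 / 3) *_) (ℚP.+-identityʳ (ℕ→ℚ 3 * U 0 n)) ⟨
    (+ 1 / 3) * (ℕ→ℚ 3 * U 0 n + 0ℚ)    ≡⟨ cong ((+ 1 / 3) *_) (U-recurrence 0 n) ⟩
    (+ 1 / 3) * (mainTerm 0 n - ℕ→ℚ 2)  ∎
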